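{- Let $A$ be an $n\times n$ symmetric invertible matrix over the field $\mathbb{Z}_2$ all of whose diagonal entries equal $1$. Then $pr(A^{ -1}) = pr(A) = pr(n)$.
   Context: For an integer $a$, $pr(a)$ is $0$ if $a$ is even and $1$ if $a$ is odd. For a matrix $M$ with entries in $\mathbb{Z}_2$, $pr(M)$ denotes the parity of the sum of its entries (i.e. the sum of all entries computed in $\mathbb{Z}_2$). -}

module Defs where

open import Data.Bool using (Bool; true; false; _xor_; _∧_)
open import Data.Nat using (ℕ; zero; suc)
open import Data.Fin using (Fin; zero; suc; _≟_)
open import Relation.Nullary.Decidable using (does)

-- The field Z₂ is modelled as Bool: addition = xor, multiplication = ∧,
-- 0 = false, 1 = true.

Matrix : ℕ → ℕ → Set
Matrix m n = Fin m → Fin n → Bool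

Σ₂ : ∀ n → (Fin n → Bool) → Bool
Σ₂ zero    f = false
Σ₂ (suc n) f = f zero xor Σ₂ n (λ i → f (suc i))

_⊗_ : ∀ {m n p} → Matrix m n → Matrix n p → Matrix m p
(_⊗_ {n = n} A B) i k = Σ₂ n (λ j → A i j ∧ B j k)

I : ∀ n → Matrix n n
I n i j = does (i ≟ j)

_ᵀ : ∀ {m n} → Matrix m n → Matrix n m
(A ᵀ) i j = A j i

Symmetric : ∀ {n} → Matrix n n → Set
Symmetric A = ∀ i j → A i j ≡ A j i
  where open import Relation.Binary.PropositionalEquality using (_≡_)

IsInverse : ∀ {n} → Matrix n n → Matrix n n → Set
IsInverse {n} A B = (∀ i j → (A ⊗ B) i j ≡ I n i j) × (∀ i j → (B ⊗ A) i j ≡ I n i j)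
  where open import Relation.Binary.PropositionalEquality using (_≡_)
        open import Data.Product using (_×_)

Invertible : ∀ {n} → Matrix n n → Set
Invertible {n} A = Σ (Matrix n n) (λ B → IsInverse A B)
  where open import Data.Product using (Σ)

prM : ∀ {n} → Matrix n n → Bool
prM {n} M = Σ₂ n (λ i → Σ₂ n (λ j → M i j))

prℕ : ℕ → Bool
prℕ zero    = false
prℕ (suc n) = true xor prℕ n

-- Both A and B = A⁻¹ are symmetric, and for a symmetric matrix M over Z₂ the
-- off-diagonal entries cancel in pairs, so pr(M) = tr M. Applied to the
-- entrywise product of A and B this gives
--   Σᵢ Aᵢᵢ Bᵢᵢ = Σᵢⱼ Aᵢⱼ Bⱼᵢ = tr (A B) = tr I = pr(n),
-- and since every Aᵢᵢ = 1 the left-hand side is tr B = pr(B).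
module Submission where

open import Defs
open import Algebra using (CommutativeRing)
open import Data.Bool using (Bool; true; false; _xor_; _∧_)
open import Data.Bool.Properties
  using (∧-assoc; ∧-comm; xor-assoc; xor-same; xor-identityʳ; xor-∧-commutativeRing)
open import Algebra.Properties.CommutativeSemigroup
  (CommutativeRing.+-commutativeSemigroup xor-∧-commutativeRing) using (interchange)
open import Data.Nat using (ℕ; zero; suc)
open import Data.Fin using (Fin; zero; suc)
open import Data.Product using (_×_; _,_)
open import Relation.Binary.PropositionalEquality
open ≡-Reasoning

private
  variable
    l m n p : ℕ

xor-cancelˡ-middle : ∀ a r b → (a xor r) xor (r xor b) ≡ a xor b
xor-cancelˡ-middle a r b = begin
  (a xor r) xor (r xor b)  ≡⟨ xor-assoc a r (r xor b) ⟩
  a xor (r xor (r xor b))  ≡⟨ cong (a xor_) (sym (xor-assoc r r b)) ⟩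
  a xor ((r xor r) xor b)  ≡⟨ cong (λ x → a xor (x xor b)) (xor-same r) ⟩
  a xor b                  ∎

Σ₂-cong : ∀ n {f g : Fin n → Bool} → (∀ i → f i ≡ g i) → Σ₂ n f ≡ Σ₂ n g
Σ₂-cong zero    f≡g = refl
Σ₂-cong (suc n) f≡g = cong₂ _xor_ (f≡g zero) (Σ₂-cong n (λ i → f≡g (suc i)))

Σ₂-false : ∀ n → Σ₂ n (λ _ → false) ≡ false
Σ₂-false zero    = refl
Σ₂-false (suc n) = Σ₂-false n

Σ₂-true : ∀ n → Σ₂ n (λ _ → true) ≡ prℕ n
Σ₂-true zero    = refl
Σ₂-true (suc n) = cong (true xor_) (Σ₂-true n)

Σ₂-xor : ∀ n (f g : Fin n → Bool) → Σ₂ n (λ i → f i xor g i) ≡ Σ₂ n f xor Σ₂ n g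
Σ₂-xor zero    f g = refl
Σ₂-xor (suc n) f g = begin
  (f zero xor g zero) xor Σ₂ n (λ i → f (suc i) xor g (suc i))
    ≡⟨ cong ((f zero xor g zero) xor_) (Σ₂-xor n (λ i → f (suc i)) (λ i → g (suc i))) ⟩
  (f zero xor g zero) xor (Σ₂ n (λ i → f (suc i)) xor Σ₂ n (λ i → g (suc i)))
    ≡⟨ interchange (f zero) (g zero) _ _ ⟩
  Σ₂ (suc n) f xor Σ₂ (suc n) g
    ∎

Σ₂-∧ˡ : ∀ n c (f : Fin n → Bool) → Σ₂ n (λ i → c ∧ f i) ≡ c ∧ Σ₂ n f
Σ₂-∧ˡ n false f = Σ₂-false n
Σ₂-∧ˡ n true  f = refl

Σ₂-∧ʳ : ∀ n c (f : Fin n → Bool) → Σ₂ n (λ i → f i ∧ c) ≡ Σ₂ n f ∧ c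
Σ₂-∧ʳ n c f = begin
  Σ₂ n (λ i → f i ∧ c)  ≡⟨ Σ₂-cong n (λ i → ∧-comm (f i) c) ⟩
  Σ₂ n (λ i → c ∧ f i)  ≡⟨ Σ₂-∧ˡ n c f ⟩
  c ∧ Σ₂ n f            ≡⟨ ∧-comm c _ ⟩
  Σ₂ n f ∧ c            ∎

Σ₂-swap : ∀ m n (f : Fin m → Fin n → Bool) →
          Σ₂ m (λ i → Σ₂ n (f i)) ≡ Σ₂ n (λ j → Σ₂ m (λ i → f i j))
Σ₂-swap zero    n f = sym (Σ₂-false n)
Σ₂-swap (suc m) n f = begin
  Σ₂ n (f zero) xor Σ₂ m (λ i → Σ₂ n (f (suc i)))
    ≡⟨ cong (Σ₂ n (f zero) xor_) (Σ₂-swap m n (λ i → f (suc i))) ⟩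
  Σ₂ n (f zero) xor Σ₂ n (λ j → Σ₂ m (λ i → f (suc i) j))
    ≡⟨ Σ₂-xor n (f zero) _ ⟨
  Σ₂ n (λ j → Σ₂ (suc m) (λ i → f i j))
    ∎

I-symmetric : ∀ n → Symmetric (I n)
I-symmetric (suc n) zero    zero    = refl
I-symmetric (suc n) zero    (suc j) = refl
I-symmetric (suc n) (suc i) zero    = refl
I-symmetric (suc n) (suc i) (suc j) = I-symmetric n i j

I-diagonal : ∀ n (i : Fin n) → I n i i ≡ true
I-diagonal (suc n) zero    = refl
I-diagonal (suc n) (suc i) = I-diagonal n i

Σ₂-I-∧ : ∀ n (i : Fin n) (f : Fin n → Bool) → Σ₂ n (λ j → I n i j ∧ f j) ≡ f i
Σ₂-I-∧ (suc n) zero    f = trans (cong (f zero xor_) (Σ₂-false n)) (xor-identityʳ _)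
Σ₂-I-∧ (suc n) (suc i) f = Σ₂-I-∧ n i (λ j → f (suc j))

Σ₂-∧-I : ∀ n (i : Fin n) (f : Fin n → Bool) → Σ₂ n (λ j → f j ∧ I n j i) ≡ f i
Σ₂-∧-I n i f = begin
  Σ₂ n (λ j → f j ∧ I n j i)  ≡⟨ Σ₂-cong n (λ j → trans (∧-comm (f j) _) (cong (_∧ f j) (I-symmetric n j i))) ⟩
  Σ₂ n (λ j → I n i j ∧ f j)  ≡⟨ Σ₂-I-∧ n i f ⟩
  f i                         ∎

infix 4 _≐_

_≐_ : Matrix m n → Matrix m n → Set
A ≐ B = ∀ i j → A i j ≡ B i j

⊗-identityˡ : (A : Matrix m n) → I m ⊗ A ≐ A
⊗-identityˡ {m} A i j = Σ₂-I-∧ m i (λ k → A k j)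

⊗-identityʳ : (A : Matrix m n) → A ⊗ I n ≐ A
⊗-identityʳ {n = n} A i j = Σ₂-∧-I n j (A i)

⊗-congˡ : {A A′ : Matrix l m} (B : Matrix m n) → A ≐ A′ → A ⊗ B ≐ A′ ⊗ B
⊗-congˡ {m = m} B A≐A′ i j = Σ₂-cong m (λ k → cong (_∧ B k j) (A≐A′ i k))

⊗-congʳ : (A : Matrix l m) {B B′ : Matrix m n} → B ≐ B′ → A ⊗ B ≐ A ⊗ B′
⊗-congʳ {m = m} A B≐B′ i j = Σ₂-cong m (λ k → cong (A i k ∧_) (B≐B′ k j))

⊗-assoc : (A : Matrix l m) (B : Matrix m n) (C : Matrix n p) → (A ⊗ B) ⊗ C ≐ A ⊗ (B ⊗ C)
⊗-assoc {m = m} {n = n} A B C i j = begin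
  Σ₂ n (λ l → Σ₂ m (λ k → A i k ∧ B k l) ∧ C l j)
    ≡⟨ Σ₂-cong n (λ l → Σ₂-∧ʳ m (C l j) (λ k → A i k ∧ B k l)) ⟨
  Σ₂ n (λ l → Σ₂ m (λ k → (A i k ∧ B k l) ∧ C l j))
    ≡⟨ Σ₂-swap n m (λ l k → (A i k ∧ B k l) ∧ C l j) ⟩
  Σ₂ m (λ k → Σ₂ n (λ l → (A i k ∧ B k l) ∧ C l j))
    ≡⟨ Σ₂-cong m (λ k → Σ₂-cong n (λ l → ∧-assoc (A i k) (B k l) (C l j))) ⟩
  Σ₂ m (λ k → Σ₂ n (λ l → A i k ∧ (B k l ∧ C l j)))
    ≡⟨ Σ₂-cong m (λ k → Σ₂-∧ˡ n (A i k) (λ l → B k l ∧ C l j)) ⟩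
  Σ₂ m (λ k → A i k ∧ Σ₂ n (λ l → B k l ∧ C l j))
    ∎

⊗-ᵀ : (A : Matrix l m) (B : Matrix m n) → (A ⊗ B) ᵀ ≐ (B ᵀ) ⊗ (A ᵀ)
⊗-ᵀ {m = m} A B i j = Σ₂-cong m (λ k → ∧-comm (A j k) (B k i))

rightInverse-symmetric : {A B : Matrix n n} → Symmetric A → A ⊗ B ≐ I n → Symmetric B
rightInverse-symmetric {n} {A} {B} A-sym AB≐I i j = sym (begin
  B j i                    ≡⟨ ⊗-identityʳ (B ᵀ) i j ⟨
  ((B ᵀ) ⊗ I n) i j        ≡⟨ ⊗-congʳ (B ᵀ) AB≐I i j ⟨
  ((B ᵀ) ⊗ (A ⊗ B)) i j    ≡⟨ ⊗-assoc (B ᵀ) A B i j ⟨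
  (((B ᵀ) ⊗ A) ⊗ B) i j    ≡⟨ ⊗-congˡ B BᵀA≐[AB]ᵀ i j ⟩
  (((A ⊗ B) ᵀ) ⊗ B) i j    ≡⟨ ⊗-congˡ B (λ k l → trans (AB≐I l k) (I-symmetric n l k)) i j ⟩
  (I n ⊗ B) i j            ≡⟨ ⊗-identityˡ B i j ⟩
  B i j                    ∎)
  where
  BᵀA≐[AB]ᵀ : (B ᵀ) ⊗ A ≐ (A ⊗ B) ᵀ
  BᵀA≐[AB]ᵀ k l = trans (⊗-congʳ (B ᵀ) A-sym k l) (sym (⊗-ᵀ A B k l))

trace : Matrix n n → Bool
trace {n} M = Σ₂ n (λ i → M i i)

-- Row 0 and column 0 contribute the same off-diagonal sum, which cancels.
prM-symmetric : (M : Matrix n n) → Symmetric M → prM M ≡ trace M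
prM-symmetric {zero}  M M-sym = refl
prM-symmetric {suc n} M M-sym = begin
  (M zero zero xor row) xor Σ₂ n (λ i → M (suc i) zero xor Σ₂ n (M (suc i) ∘suc))
    ≡⟨ cong ((M zero zero xor row) xor_) (Σ₂-xor n (λ i → M (suc i) zero) _) ⟩
  (M zero zero xor row) xor (Σ₂ n (λ i → M (suc i) zero) xor prM M′)
    ≡⟨ cong (λ c → (M zero zero xor row) xor (c xor prM M′)) (Σ₂-cong n (λ i → M-sym (suc i) zero)) ⟩
  (M zero zero xor row) xor (row xor prM M′)
    ≡⟨ xor-cancelˡ-middle (M zero zero) row (prM M′) ⟩
  M zero zero xor prM M′
    ≡⟨ cong (M zero zero xor_) (prM-symmetric M′ (λ i j → M-sym (suc i) (suc j))) ⟩
  trace M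
    ∎
  where
  _∘suc : (Fin (suc n) → Bool) → Fin n → Bool
  (f ∘suc) j = f (suc j)
  row : Bool
  row = Σ₂ n (M zero ∘suc)
  M′ : Matrix n n
  M′ i j = M (suc i) (suc j)

-- Σᵢⱼ Aᵢⱼ Bᵢⱼ is both pr of a symmetric matrix and tr (A B).
trace-∧-inverse : {A B : Matrix n n} → Symmetric A → Symmetric B → A ⊗ B ≐ I n →
                  Σ₂ n (λ i → A i i ∧ B i i) ≡ prℕ n
trace-∧-inverse {n} {A} {B} A-sym B-sym AB≐I = begin
  trace A∧B                          ≡⟨ prM-symmetric A∧B A∧B-symmetric ⟨
  prM A∧B                            ≡⟨ Σ₂-cong n (λ i → Σ₂-cong n (λ j → cong (A i j ∧_) (B-sym i j))) ⟩
  trace (A ⊗ B)                      ≡⟨ Σ₂-cong n (λ i → trans (AB≐I i i) (I-diagonal n i)) ⟩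
  Σ₂ n (λ _ → true)                  ≡⟨ Σ₂-true n ⟩
  prℕ n                              ∎
  where
  A∧B : Matrix n n
  A∧B i j = A i j ∧ B i j
  A∧B-symmetric : Symmetric A∧B
  A∧B-symmetric i j = cong₂ _∧_ (A-sym i j) (B-sym i j)

lemma2p1 : (n : ℕ) (A : Matrix n n) →
    Symmetric A →
    (∀ i → A i i ≡ true) →
    (B : Matrix n n) → IsInverse A B →
    (prM B ≡ prM A) × (prM A ≡ prℕ n)
lemma2p1 n A A-sym diag-A B (AB≐I , _) = trans prB≡n (sym prA≡n) , prA≡n
  where
  B-sym : Symmetric B
  B-sym = rightInverse-symmetric A-sym AB≐I
  prA≡n : prM A ≡ prℕ n
  prA≡n = begin
    prM A              ≡⟨ prM-symmetric A A-sym ⟩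
    trace A            ≡⟨ Σ₂-cong n diag-A ⟩
    Σ₂ n (λ _ → true)  ≡⟨ Σ₂-true n ⟩
    prℕ n              ∎
  prB≡n : prM B ≡ prℕ n
  prB≡n = begin
    prM B                         ≡⟨ prM-symmetric B B-sym ⟩
    trace B                       ≡⟨ Σ₂-cong n (λ i → cong (_∧ B i i) (diag-A i)) ⟨
    Σ₂ n (λ i → A i i ∧ B i i)    ≡⟨ trace-∧-inverse A-sym B-sym AB≐I ⟩
    prℕ n                         ∎
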